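{- Let $g$ be a loopless connected planar graph with at least $2$ vertices, with a fixed smooth embedding in $\mathbb{R}^2$, and let $G$ be the graph canonically constructed from $g$ as described in the context. Then \[ M(G)=\sum_{A\in\mathrm{Luc}(g)} 2^{\mathrm{Sp}(A)}, \] where $M(G)$ is the number of perfect matchings of $G$, $\mathrm{Luc}(g)$ is the set of Lucas-colorings of $g$ and $\mathrm{Sp}(A)$ is the number of special vertices of $A$.
   Context: Lucas-coloring: for a planar graph $g=(V,E)$ with a fixed embedding, each set $E_v$ of edges incident to a vertex $v$ carries a cyclic order. A Lucas-coloring of $g$ is a coloring $A:E\to\{y,n\}$ such that for every vertex $v$, the edges of $E_v$ colored $n$ can be partitioned into pairs of edges that are consecutive in the cyclic order of $E_v$. A vertex is special for $A$ if all its incident edges are colored $n$; $\mathrm{Sp}(A)$ is the number of special vertices. Polygon graph $P_m$ ($m\ge 2$): the cycle on $m$ vertices, where $P_2$ means two vertices joined by two parallel edges. Construction of $G$: for each vertex $v_i$ of $g$ with degree $n_i=\deg(v_i)\ge 2$, choose a small closed disk $B_i$ centered at $v_i$ whose boundary circle meets the embedded graph in exactly $n_i$ points, one on each edge incident to $v_i$ (the disks being pairwise disjoint). Replace the part of $g$ inside $B_i$ by the polygon graph $P_{n_i}$ whose vertices are these $n_i$ boundary points, joined consecutively in their cyclic order around the circle. Vertices of degree $1$ are left unchanged. Each edge of $g$ contributes the remaining segment of it outside the disks as an edge of $G$ (joining two boundary points, or a degree-one vertex and a boundary point). -}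

module Defs where

open import Data.Nat using (ℕ; zero; suc; _+_; _*_; _^_; _≤ᵇ_; _<ᵇ_)
import Data.Nat as ℕ
open import Data.Fin using (Fin; zero; suc; toℕ)
import Data.Fin.Properties as FinP
open import Data.Bool using (Bool; true; false; not; _∧_; _∨_; if_then_else_)
import Data.Bool.Properties as BoolP
open import Data.Product using (Σ; ∃; ∃-syntax; _×_; _,_; proj₁; proj₂)
open import Data.Product.Properties using (≡-dec)
open import Function using (_∘_)
open import Function.Bundles using (_↔_; Inverse)
open import Relation.Binary.PropositionalEquality using (_≡_; _≢_)
open import Relation.Nullary.Decidable using (⌊_⌋; Dec)

allFin : (k : ℕ) → (Fin k → Bool) → Bool
allFin zero    p = true
allFin (suc k) p = p zero ∧ allFin k (p ∘ suc)

sumFin : (k : ℕ) → (Fin k → ℕ) → ℕ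
sumFin zero    f = 0
sumFin (suc k) f = f zero + sumFin k (f ∘ suc)

countFin : (k : ℕ) → (Fin k → Bool) → ℕ
countFin k p = sumFin k (λ i → if p i then 1 else 0)

cons : {k : ℕ} → Bool → (Fin k → Bool) → Fin (suc k) → Bool
cons b h zero    = b
cons b h (suc i) = h i

sumFun : (k : ℕ) → ((Fin k → Bool) → ℕ) → ℕ
sumFun zero    F = F (λ ())
sumFun (suc k) F = sumFun k (λ h → F (cons false h)) + sumFun k (λ h → F (cons true h))

anyFun : (k : ℕ) → ((Fin k → Bool) → Bool) → Bool
anyFun zero    F = F (λ ())
anyFun (suc k) F = anyFun k (λ h → F (cons false h)) ∨ anyFun k (λ h → F (cons true h))

b2n : Bool → ℕ
b2n true  = 1
b2n false = 0

-- Graphs with a fixed embedding, as rotation systems (combinatorial maps).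
-- Vertices Fin n, edges Fin m; each edge e has two ends (darts) (e , false)
-- and (e , true).

Dart : ℕ → Set
Dart m = Fin m × Bool

_≟D_ : {m : ℕ} (d d' : Dart m) → Dec (d ≡ d')
_≟D_ = ≡-dec FinP._≟_ BoolP._≟_

endpoint : {n m : ℕ} → (Fin m → Bool → Fin n) → Dart m → Fin n
endpoint ends (e , b) = ends e b

iterate : {A : Set} → (A → A) → ℕ → A → A
iterate f zero    x = x
iterate f (suc k) x = f (iterate f k x)

-- A graph with a rotation system: σ is the permutation of darts sending a
-- dart to the next dart around the same vertex; on the darts of each vertex
-- it acts as a single cycle (the cyclic order of E_v).
record RotationSystem (n m : ℕ) : Set where
  field
    ends         : Fin m → Bool → Fin n
    σ            : Dart m ↔ Dart m
    σ-vertex     : ∀ d → endpoint ends (Inverse.to σ d) ≡ endpoint ends d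
    σ-transitive : ∀ d d' → endpoint ends d ≡ endpoint ends d' →
                   ∃[ k ] iterate (Inverse.to σ) k d ≡ d'

module _ {n m : ℕ} (R : RotationSystem n m) where
  open RotationSystem R

  vert : Dart m → Fin n
  vert = endpoint ends

  next : Dart m → Dart m
  next = Inverse.to σ

  prev : Dart m → Dart m
  prev = Inverse.from σ

  Loopless : Set
  Loopless = ∀ e → ends e false ≢ ends e true

  data Reach : Fin n → Fin n → Set where
    here : ∀ {u} → Reach u u
    step : ∀ {w} (e : Fin m) (b : Bool) → Reach (ends e (not b)) w → Reach (ends e b) w

  Connected : Set
  Connected = ∀ u v → Reach u v

  allDart : (Dart m → Bool) → Bool
  allDart p = allFin m (λ e → p (e , false) ∧ p (e , true))

  countDart : (Dart m → Bool) → ℕ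
  countDart p = countFin m (λ e → p (e , false)) + countFin m (λ e → p (e , true))

  dartFun : (Fin m → Bool) → (Fin m → Bool) → Dart m → Bool
  dartFun f0 f1 (e , false) = f0 e
  dartFun f0 f1 (e , true)  = f1 e

  sumDartFun : ((Dart m → Bool) → ℕ) → ℕ
  sumDartFun F = sumFun m (λ f0 → sumFun m (λ f1 → F (dartFun f0 f1)))

  anyDartFun : ((Dart m → Bool) → Bool) → Bool
  anyDartFun F = anyFun m (λ f0 → anyFun m (λ f1 → F (dartFun f0 f1)))

  -- degree-one vertices are exactly those whose dart is fixed by σ
  fixed : Dart m → Bool
  fixed d = ⌊ next d ≟D d ⌋

  -- Planarity of the embedding: Euler's formula V - E + F = 2, where the
  -- faces are the orbits of the face permutation φ = σ ∘ (flip end).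
  flipD : Dart m → Dart m
  flipD (e , b) = (e , not b)

  φ : Dart m → Dart m
  φ d = next (flipD d)

  key : Dart m → ℕ
  key (e , b) = toℕ e * 2 + b2n b

  -- d represents its face iff it has the smallest key in its φ-orbit
  -- (orbits have length ≤ 2m, so iterating 2m times covers the orbit)
  isFaceRep : Dart m → Bool
  isFaceRep d = allFin (2 * m) (λ k → key d ≤ᵇ key (iterate φ (toℕ k) d))

  numFaces : ℕ
  numFaces = countDart isFaceRep

  Planar : Set
  Planar = n + numFaces ≡ 2 + m

  -- Vertices of G = darts of g (the boundary point of B_i on
  -- an edge at v_i, or the degree-one vertex itself when deg v = 1).
  -- Edges of G:  outer e (e : Fin m) joining (e,false) and (e,true);
  --              polygon edge  d  joining d and next d, present iff d is
  --              not fixed by σ (i.e. its vertex has degree ≥ 2); for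
  --              degree 2 this gives the two parallel edges of P_2.
  -- A set of edges is given by  outer : Fin m → Bool, inner : Dart m → Bool.
  -- The edges of G at the vertex d are: outer (proj₁ d), polygon edge d,
  -- polygon edge (prev d).
  isPerfectMatching : (Fin m → Bool) → (Dart m → Bool) → Bool
  isPerfectMatching outer inner =
    allDart (λ d → (not (fixed d) ∨ not (inner d))
                 ∧ ⌊ b2n (outer (proj₁ d)) + b2n (inner d) + b2n (inner (prev d)) ℕ.≟ 1 ⌋)

  numPerfectMatchings : ℕ
  numPerfectMatchings =
    sumFun m (λ outer → sumDartFun (λ inner → if isPerfectMatching outer inner then 1 else 0))

  -- A : Fin m → Bool, with  true = n  and  false = y.
  -- A partition of the n-edges at each vertex into pairs of consecutive
  -- edges is given by P : Dart m → Bool, P d = true meaning {d , next d}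
  -- is one of the pairs (only allowed if next d ≠ d); every dart must lie
  -- in exactly one chosen pair if its edge is colored n, none otherwise.
  isConsecutivePairing : (Fin m → Bool) → (Dart m → Bool) → Bool
  isConsecutivePairing A P =
    allDart (λ d → (not (fixed d) ∨ not (P d))
                 ∧ ⌊ b2n (P d) + b2n (P (prev d)) ℕ.≟ b2n (A (proj₁ d)) ⌋)

  isLucasColoring : (Fin m → Bool) → Bool
  isLucasColoring A = anyDartFun (isConsecutivePairing A)

  isSpecial : (Fin m → Bool) → Fin n → Bool
  isSpecial A v = allDart (λ d → not ⌊ vert d FinP.≟ v ⌋ ∨ A (proj₁ d))

  Sp : (Fin m → Bool) → ℕ
  Sp A = countFin n (isSpecial A)

  lucasSum : ℕ
  lucasSum = sumFun m (λ A → if isLucasColoring A then 2 ^ Sp A else 0)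

{-# OPTIONS --safe #-}
-- Contract each polygon of G back to its vertex. A perfect matching of G is a set of
-- outer edges, whose complement is the set of n-edges of a coloring A of g, together
-- with, at each vertex v, a perfect matching of the polygon points left uncovered, that
-- is, a partition of the n-edges of E_v into consecutive pairs. So M(G) is the sum over
-- all colorings A of the number of such pairings. Going around a vertex, a pairing is
-- determined by its value at one dart, so two pairings of A differ at each vertex by a
-- constant flip: it is forced to be trivial at a vertex with a y-edge and is free at a
-- special vertex. A Lucas-coloring therefore has exactly 2^Sp(A) pairings. This needs
-- every vertex to carry a dart (an isolated vertex would be vacuously special), which
-- connectivity and n ≥ 2 guarantee.
module Submission where

open import Defs
open import Data.Bool using (Bool; true; false; not; _∧_; _∨_; _xor_; if_then_else_; T)
open import Data.Bool.Properties
  using (_≟_; T-∧; T-∨; T-≡; T-not-≡; ∧-zeroʳ; xor-same; xor-inverseˡ; xor-annihilates-not)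
open import Data.Empty using (⊥-elim)
open import Data.Fin using (Fin; zero; suc)
import Data.Fin.Properties as FinP
open import Data.Nat using (ℕ; zero; suc; _+_; _^_; _≤_; s≤s; z≤n)
import Data.Nat as ℕ
open import Data.Nat.Properties using (+-comm; +-identityʳ; +-commutativeSemigroup)
open import Algebra.Properties.CommutativeSemigroup +-commutativeSemigroup using (interchange)
open import Data.Product using (∃; _×_; _,_; proj₁; proj₂)
open import Data.Sum using (inj₁; inj₂)
open import Data.Unit using (tt)
open import Function using (_∘_; Equivalence)
open import Function.Bundles using (Inverse)
open import Relation.Binary.PropositionalEquality
open import Relation.Nullary using (Dec; ¬_)
open import Relation.Nullary.Decidable using (⌊_⌋; toWitness; fromWitness)

open Equivalence using (to; from)

ι : Bool → ℕ
ι b = if b then 1 else 0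

T-injective : ∀ {a b} → (T a → T b) → (T b → T a) → a ≡ b
T-injective {false} {false} _ _ = refl
T-injective {false} {true}  _ g = ⊥-elim (g tt)
T-injective {true}  {false} f _ = ⊥-elim (f tt)
T-injective {true}  {true}  _ _ = refl

T-⇒⁻ : ∀ {a b} → T (not a ∨ b) → T a → T b
T-⇒⁻ {true} t _ = t

T-⇒⁺ : ∀ {a b} → (T a → T b) → T (not a ∨ b)
T-⇒⁺ {false} _ = tt
T-⇒⁺ {true}  f = f tt

T-⌊⌋-⇒⁻ : ∀ {p} {X : Set p} {b} (x? : Dec X) → T (not ⌊ x? ⌋ ∨ b) → X → T b
T-⌊⌋-⇒⁻ x? t x = T-⇒⁻ t (fromWitness {a? = x?} x)

T-⌊⌋-⇒⁺ : ∀ {p} {X : Set p} {b} (x? : Dec X) → (X → T b) → T (not ⌊ x? ⌋ ∨ b)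
T-⌊⌋-⇒⁺ x? f = T-⇒⁺ (f ∘ toWitness {a? = x?})

ι-false : ∀ {b} → ¬ T b → ι b ≡ 0
ι-false {false} _ = refl
ι-false {true}  f = ⊥-elim (f tt)

xor-cancelʳ : ∀ x y → (x xor y) xor y ≡ x
xor-cancelʳ false y = xor-same y
xor-cancelʳ true  y = xor-inverseˡ y

xor-cancelˡ : ∀ x y z → (x xor y) xor (x xor z) ≡ y xor z
xor-cancelˡ false y z = refl
xor-cancelˡ true  y z = xor-annihilates-not y z

b2n-+⇒xor : ∀ x y a → b2n x + b2n y ≡ b2n a → x ≡ a xor y
b2n-+⇒xor false false false _ = refl
b2n-+⇒xor false true  true  _ = refl
b2n-+⇒xor true  false true  _ = refl
b2n-+⇒xor false false true  ()
b2n-+⇒xor false true  false ()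
b2n-+⇒xor true  false false ()
b2n-+⇒xor true  true  false ()
b2n-+⇒xor true  true  true  ()

b2n-+≡0 : ∀ x y → b2n x + b2n y ≡ 0 → x ≡ false
b2n-+≡0 false _ _ = refl

b2n-+-not : ∀ x y → b2n x + b2n y ≡ 1 → b2n (not x) + b2n (not y) ≡ 1
b2n-+-not false true  _ = refl
b2n-+-not true  false _ = refl
b2n-+-not false false ()
b2n-+-not true  true  ()

b2n-double≢1 : ∀ x → b2n x + b2n x ≢ 1
b2n-double≢1 false ()
b2n-double≢1 true  ()

allFin⁻ : ∀ k {p : Fin k → Bool} → T (allFin k p) → ∀ i → T (p i)
allFin⁻ (suc k) t zero    = proj₁ (to T-∧ t)
allFin⁻ (suc k) t (suc i) = allFin⁻ k (proj₂ (to T-∧ t)) i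

allFin⁺ : ∀ k {p : Fin k → Bool} → (∀ i → T (p i)) → T (allFin k p)
allFin⁺ zero    _ = tt
allFin⁺ (suc k) t = from T-∧ (t zero , allFin⁺ k (t ∘ suc))

allFin-cong : ∀ k {p q : Fin k → Bool} → p ≗ q → allFin k p ≡ allFin k q
allFin-cong zero    _   = refl
allFin-cong (suc k) p≗q = cong₂ _∧_ (p≗q zero) (allFin-cong k (p≗q ∘ suc))

allFin-∧ : ∀ k (p q : Fin k → Bool) → allFin k (λ i → p i ∧ q i) ≡ allFin k p ∧ allFin k q
allFin-∧ zero    p q = refl
allFin-∧ (suc k) p q with p zero | q zero
... | false | _     = refl
... | true  | true  = allFin-∧ k (p ∘ suc) (q ∘ suc)
... | true  | false = sym (∧-zeroʳ (allFin k (p ∘ suc)))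

infix 4 _≐_ _⊆ᵇ_

_≐_ : ∀ {k} → (Fin k → Bool) → (Fin k → Bool) → Bool
_≐_ {k} f g = allFin k (λ i → ⌊ f i ≟ g i ⌋)

_⊆ᵇ_ : ∀ {k} → (Fin k → Bool) → (Fin k → Bool) → Bool
_⊆ᵇ_ {k} f s = allFin k (λ i → not (f i) ∨ s i)

≐⇒≗ : ∀ k {f g : Fin k → Bool} → T (f ≐ g) → f ≗ g
≐⇒≗ k t i = toWitness (allFin⁻ k t i)

≗⇒≐ : ∀ k {f g : Fin k → Bool} → f ≗ g → T (f ≐ g)
≗⇒≐ k f≗g = allFin⁺ k (λ i → fromWitness (f≗g i))

cons-cong : ∀ {k} b {f g : Fin k → Bool} → f ≗ g → cons b f ≗ cons b g
cons-cong b f≗g zero    = refl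
cons-cong b f≗g (suc i) = f≗g i

not-cons : ∀ {k} b (f : Fin k → Bool) → not ∘ cons b f ≗ cons (not b) (not ∘ f)
not-cons b f zero    = refl
not-cons b f (suc i) = refl

sumFun-cong : ∀ k {F G : (Fin k → Bool) → ℕ} → (∀ f → F f ≡ G f) → sumFun k F ≡ sumFun k G
sumFun-cong zero    F≡G = F≡G _
sumFun-cong (suc k) F≡G =
  cong₂ _+_ (sumFun-cong k (F≡G ∘ cons false)) (sumFun-cong k (F≡G ∘ cons true))

sumFun-zero : ∀ k {F : (Fin k → Bool) → ℕ} → (∀ f → F f ≡ 0) → sumFun k F ≡ 0
sumFun-zero zero    F≡0 = F≡0 _
sumFun-zero (suc k) F≡0 =
  cong₂ _+_ (sumFun-zero k (F≡0 ∘ cons false)) (sumFun-zero k (F≡0 ∘ cons true))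

sumFun-+ : ∀ k (F G : (Fin k → Bool) → ℕ) → sumFun k (λ f → F f + G f) ≡ sumFun k F + sumFun k G
sumFun-+ zero    F G = refl
sumFun-+ (suc k) F G = begin
    sumFun k (λ h → F₀ h + G₀ h) + sumFun k (λ h → F₁ h + G₁ h)
  ≡⟨ cong₂ _+_ (sumFun-+ k F₀ G₀) (sumFun-+ k F₁ G₁) ⟩
    (sumFun k F₀ + sumFun k G₀) + (sumFun k F₁ + sumFun k G₁)
  ≡⟨ interchange (sumFun k F₀) (sumFun k G₀) (sumFun k F₁) (sumFun k G₁) ⟩
    (sumFun k F₀ + sumFun k F₁) + (sumFun k G₀ + sumFun k G₁)
  ∎
  where
  open ≡-Reasoning
  F₀ F₁ G₀ G₁ : (Fin k → Bool) → ℕ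
  F₀ = F ∘ cons false
  F₁ = F ∘ cons true
  G₀ = G ∘ cons false
  G₁ = G ∘ cons true

sumFun-comm : ∀ a b (H : (Fin a → Bool) → (Fin b → Bool) → ℕ) →
              sumFun a (λ f → sumFun b (H f)) ≡ sumFun b (λ g → sumFun a (λ f → H f g))
sumFun-comm zero    b H = refl
sumFun-comm (suc a) b H =
  trans (cong₂ _+_ (sumFun-comm a b (H ∘ cons false)) (sumFun-comm a b (H ∘ cons true)))
        (sym (sumFun-+ b _ _))

sumFun-point : ∀ k (g : Fin k → Bool) → sumFun k (λ f → ι (f ≐ g)) ≡ 1
sumFun-point zero    g = refl
sumFun-point (suc k) g with g zero
... | false = cong₂ _+_ (sumFun-point k (g ∘ suc)) (sumFun-zero k (λ _ → refl))
... | true  = cong₂ _+_ (sumFun-zero k (λ _ → refl)) (sumFun-point k (g ∘ suc))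

sumFun-∧-point : ∀ k a (g : Fin k → Bool) → sumFun k (λ f → ι (a ∧ (f ≐ g))) ≡ ι a
sumFun-∧-point k false g = sumFun-zero k (λ _ → refl)
sumFun-∧-point k true  g = sumFun-point k g

sumFun-not : ∀ k (F : (Fin k → Bool) → ℕ) → (∀ {f g} → f ≗ g → F f ≡ F g) →
             sumFun k (λ f → F (not ∘ f)) ≡ sumFun k F
sumFun-not zero    F F-cong = F-cong (λ ())
sumFun-not (suc k) F F-cong = begin
    sumFun k (λ h → F (not ∘ cons false h)) + sumFun k (λ h → F (not ∘ cons true h))
  ≡⟨ cong₂ _+_ (sumFun-cong k (λ h → F-cong (not-cons false h)))
               (sumFun-cong k (λ h → F-cong (not-cons true h))) ⟩
    sumFun k (λ h → F₁ (not ∘ h)) + sumFun k (λ h → F₀ (not ∘ h))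
  ≡⟨ cong₂ _+_ (sumFun-not k F₁ (F-cong ∘ cons-cong true))
               (sumFun-not k F₀ (F-cong ∘ cons-cong false)) ⟩
    sumFun k F₁ + sumFun k F₀
  ≡⟨ +-comm (sumFun k F₁) (sumFun k F₀) ⟩
    sumFun k F₀ + sumFun k F₁
  ∎
  where
  open ≡-Reasoning
  F₀ F₁ : (Fin k → Bool) → ℕ
  F₀ = F ∘ cons false
  F₁ = F ∘ cons true

sumFun-⊆ᵇ : ∀ k (s : Fin k → Bool) → sumFun k (λ f → ι (f ⊆ᵇ s)) ≡ 2 ^ countFin k s
sumFun-⊆ᵇ zero    s = refl
sumFun-⊆ᵇ (suc k) s with s zero
... | false = trans (cong₂ _+_ (sumFun-⊆ᵇ k (s ∘ suc)) (sumFun-zero k (λ _ → refl)))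
                    (+-identityʳ _)
... | true  = trans (cong₂ _+_ (sumFun-⊆ᵇ k (s ∘ suc)) (sumFun-⊆ᵇ k (s ∘ suc)))
                    (cong (2 ^ countFin k (s ∘ suc) +_) (sym (+-identityʳ _)))

anyFun-∃ : ∀ k {F : (Fin k → Bool) → Bool} → T (anyFun k F) → ∃ λ f → T (F f)
anyFun-∃ zero    t = (λ ()) , t
anyFun-∃ (suc k) t with to T-∨ t
... | inj₁ t₀ = let (f , t′) = anyFun-∃ k t₀ in cons false f , t′
... | inj₂ t₁ = let (f , t′) = anyFun-∃ k t₁ in cons true f , t′

sumFun-¬anyFun : ∀ k {F : (Fin k → Bool) → Bool} (H : (Fin k → Bool) → ℕ) → ¬ T (anyFun k F) →
                 (∀ f → ¬ T (F f) → H f ≡ 0) → sumFun k H ≡ 0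
sumFun-¬anyFun zero    H ¬t H≡0 = H≡0 _ ¬t
sumFun-¬anyFun (suc k) H ¬t H≡0 =
  cong₂ _+_ (sumFun-¬anyFun k (H ∘ cons false) (¬t ∘ from T-∨ ∘ inj₁) (H≡0 ∘ cons false))
            (sumFun-¬anyFun k (H ∘ cons true)  (¬t ∘ from T-∨ ∘ inj₂) (H≡0 ∘ cons true))

another-element : ∀ {n} → 2 ≤ n → (v : Fin n) → ∃ λ w → v ≢ w
another-element (s≤s (s≤s z≤n)) zero    = suc zero , λ ()
another-element (s≤s (s≤s z≤n)) (suc _) = zero , λ ()

module _ {n m : ℕ} (R : RotationSystem n m) where
  open RotationSystem R using (σ; σ-vertex; σ-transitive)

  prev-next : ∀ d → prev R (next R d) ≡ d
  prev-next = Inverse.strictlyInverseʳ σ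

  vert-prev : ∀ d → vert R (prev R d) ≡ vert R d
  vert-prev d = trans (sym (σ-vertex (prev R d))) (cong (vert R) (Inverse.strictlyInverseˡ σ d))

  every-vertex-has-dart : 2 ≤ n → Connected R → ∀ v → ∃ λ d → vert R d ≡ v
  every-vertex-has-dart 2≤n connected v =
    let (w , v≢w) = another-element 2≤n v in first-dart (connected v w) v≢w
    where
    first-dart : ∀ {u w} → Reach R u w → u ≢ w → ∃ λ d → vert R d ≡ u
    first-dart here         u≢u = ⊥-elim (u≢u refl)
    first-dart (step e b _) _   = (e , b) , refl

  allDart⁻ : ∀ {p : Dart m → Bool} → T (allDart R p) → ∀ d → T (p d)
  allDart⁻ t (e , false) = proj₁ (to T-∧ (allFin⁻ m t e))
  allDart⁻ t (e , true)  = proj₂ (to T-∧ (allFin⁻ m t e))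

  allDart⁺ : ∀ {p : Dart m → Bool} → (∀ d → T (p d)) → T (allDart R p)
  allDart⁺ t = allFin⁺ m (λ e → from T-∧ (t (e , false) , t (e , true)))

  allDart-cong : ∀ {p q : Dart m → Bool} → p ≗ q → allDart R p ≡ allDart R q
  allDart-cong p≗q = allFin-cong m (λ e → cong₂ _∧_ (p≗q (e , false)) (p≗q (e , true)))

  infix 4 _≐ᴰ_

  _≐ᴰ_ : (Dart m → Bool) → (Dart m → Bool) → Bool
  P ≐ᴰ Q = allDart R (λ d → ⌊ P d ≟ Q d ⌋)

  ≐ᴰ⇒≗ : ∀ {P Q} → T (P ≐ᴰ Q) → P ≗ Q
  ≐ᴰ⇒≗ {P} {Q} t d = toWitness (allDart⁻ {p = λ d → ⌊ P d ≟ Q d ⌋} t d)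

  ≗⇒≐ᴰ : ∀ {P Q} → P ≗ Q → T (P ≐ᴰ Q)
  ≗⇒≐ᴰ {P} {Q} P≗Q = allDart⁺ {p = λ d → ⌊ P d ≟ Q d ⌋} (λ d → fromWitness (P≗Q d))

  sumDartFun-cong : ∀ {F G : (Dart m → Bool) → ℕ} → (∀ P → F P ≡ G P) →
                    sumDartFun R F ≡ sumDartFun R G
  sumDartFun-cong F≡G = sumFun-cong m (λ f₀ → sumFun-cong m (λ f₁ → F≡G _))

  sumDartFun-comm : ∀ k (H : (Dart m → Bool) → (Fin k → Bool) → ℕ) →
                    sumDartFun R (λ P → sumFun k (H P)) ≡ sumFun k (λ f → sumDartFun R (λ P → H P f))
  sumDartFun-comm k H =
    trans (sumFun-cong m (λ f₀ → sumFun-comm m k (λ f₁ → H (dartFun R f₀ f₁))))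
          (sumFun-comm m k (λ f₀ f → sumFun m (λ f₁ → H (dartFun R f₀ f₁) f)))

  sumDartFun-∧-point : ∀ a (Q : Dart m → Bool) → sumDartFun R (λ P → ι (a ∧ (P ≐ᴰ Q))) ≡ ι a
  sumDartFun-∧-point false Q = sumFun-zero m (λ _ → sumFun-zero m (λ _ → refl))
  sumDartFun-∧-point true  Q = begin
      sumFun m (λ f₀ → sumFun m (λ f₁ → ι (allFin m (λ e → ⌊ f₀ e ≟ Q₀ e ⌋ ∧ ⌊ f₁ e ≟ Q₁ e ⌋))))
    ≡⟨ sumFun-cong m (λ f₀ → sumFun-cong m (λ f₁ → cong ι (allFin-∧ m _ _))) ⟩
      sumFun m (λ f₀ → sumFun m (λ f₁ → ι ((f₀ ≐ Q₀) ∧ (f₁ ≐ Q₁))))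
    ≡⟨ sumFun-cong m (λ f₀ → sumFun-∧-point m (f₀ ≐ Q₀) Q₁) ⟩
      sumFun m (λ f₀ → ι (f₀ ≐ Q₀))
    ≡⟨ sumFun-point m Q₀ ⟩
      1
    ∎
    where
    open ≡-Reasoning
    Q₀ Q₁ : Fin m → Bool
    Q₀ e = Q (e , false)
    Q₁ e = Q (e , true)

  anyDartFun-∃ : ∀ {F : (Dart m → Bool) → Bool} → T (anyDartFun R F) → ∃ λ P → T (F P)
  anyDartFun-∃ t =
    let (f₀ , t₀) = anyFun-∃ m t; (f₁ , t₁) = anyFun-∃ m t₀ in dartFun R f₀ f₁ , t₁

  sumDartFun-¬anyDartFun : ∀ {F : (Dart m → Bool) → Bool} (H : (Dart m → Bool) → ℕ) →
                           ¬ T (anyDartFun R F) → (∀ P → ¬ T (F P) → H P ≡ 0) → sumDartFun R H ≡ 0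
  sumDartFun-¬anyDartFun H ¬t H≡0 =
    sumFun-¬anyFun m _ ¬t (λ f₀ ¬t₀ → sumFun-¬anyFun m _ ¬t₀ (λ f₁ → H≡0 (dartFun R f₀ f₁)))

  sumDartFun-correspondence :
    ∀ k (p : (Dart m → Bool) → Bool) (q : (Fin k → Bool) → Bool)
    (φ : (Fin k → Bool) → Dart m → Bool) (ψ : (Dart m → Bool) → Fin k → Bool) →
    (∀ {P f} → T (p P) → f ≗ ψ P → T (q f) × P ≗ φ f) →
    (∀ {P f} → T (q f) → P ≗ φ f → T (p P) × f ≗ ψ P) →
    sumDartFun R (ι ∘ p) ≡ sumFun k (ι ∘ q)
  sumDartFun-correspondence k p q φ ψ forth back = begin
      sumDartFun R (λ P → ι (p P))
    ≡⟨ sumDartFun-cong (λ P → sym (sumFun-∧-point k (p P) (ψ P))) ⟩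
      sumDartFun R (λ P → sumFun k (λ f → ι (p P ∧ (f ≐ ψ P))))
    ≡⟨ sumDartFun-cong (λ P → sumFun-cong k (λ f → cong ι (same-graph P f))) ⟩
      sumDartFun R (λ P → sumFun k (λ f → ι (q f ∧ (P ≐ᴰ φ f))))
    ≡⟨ sumDartFun-comm k (λ P f → ι (q f ∧ (P ≐ᴰ φ f))) ⟩
      sumFun k (λ f → sumDartFun R (λ P → ι (q f ∧ (P ≐ᴰ φ f))))
    ≡⟨ sumFun-cong k (λ f → sumDartFun-∧-point (q f) (φ f)) ⟩
      sumFun k (λ f → ι (q f))
    ∎
    where
    open ≡-Reasoning
    same-graph : ∀ P f → (p P ∧ (f ≐ ψ P)) ≡ (q f ∧ (P ≐ᴰ φ f))
    same-graph P f = T-injective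
      (λ t → let (qf , P≗φf) = forth (proj₁ (to T-∧ t)) (≐⇒≗ k (proj₂ (to T-∧ t)))
             in from T-∧ (qf , ≗⇒≐ᴰ P≗φf))
      (λ t → let (pP , f≗ψP) = back (proj₁ (to T-∧ t)) (≐ᴰ⇒≗ (proj₂ (to T-∧ t)))
             in from T-∧ (pP , ≗⇒≐ k f≗ψP))

  covered? : (A : Fin m → Bool) (P : Dart m → Bool) (d : Dart m) →
             Dec (b2n (P d) + b2n (P (prev R d)) ≡ b2n (A (proj₁ d)))
  covered? A P d = b2n (P d) + b2n (P (prev R d)) ℕ.≟ b2n (A (proj₁ d))

  pairedAt : (Fin m → Bool) → (Dart m → Bool) → Dart m → Bool
  pairedAt A P d = (not (fixed R d) ∨ not (P d)) ∧ ⌊ covered? A P d ⌋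

  record IsConsecutivePairing (A : Fin m → Bool) (P : Dart m → Bool) : Set where
    field
      unpaired-at-leaf : ∀ d → next R d ≡ d → P d ≡ false
      covers           : ∀ d → b2n (P d) + b2n (P (prev R d)) ≡ b2n (A (proj₁ d))
  open IsConsecutivePairing

  isConsecutivePairing⁻ : ∀ {A P} → T (isConsecutivePairing R A P) → IsConsecutivePairing A P
  isConsecutivePairing⁻ {A} {P} t .unpaired-at-leaf d leaf =
    to T-not-≡ (T-⌊⌋-⇒⁻ (next R d ≟D d) (proj₁ (to T-∧ (allDart⁻ {pairedAt A P} t d))) leaf)
  isConsecutivePairing⁻ {A} {P} t .covers d =
    toWitness {a? = covered? A P d} (proj₂ (to T-∧ (allDart⁻ {pairedAt A P} t d)))

  isConsecutivePairing⁺ : ∀ {A P} → IsConsecutivePairing A P → T (isConsecutivePairing R A P)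
  isConsecutivePairing⁺ {A} {P} p = allDart⁺ {pairedAt A P} (λ d → from T-∧
    (T-⌊⌋-⇒⁺ (next R d ≟D d) (from T-not-≡ ∘ unpaired-at-leaf p d) , fromWitness (covers p d)))

  isConsecutivePairing-cong : ∀ {A A′ P P′} → A ≗ A′ → P ≗ P′ →
                              isConsecutivePairing R A P ≡ isConsecutivePairing R A′ P′
  isConsecutivePairing-cong {A} {A′} {P} {P′} A≗A′ P≗P′ = allDart-cong at
    where
    at : ∀ d → pairedAt A P d ≡ pairedAt A′ P′ d
    at d rewrite A≗A′ (proj₁ d) | P≗P′ d | P≗P′ (prev R d) = refl

  module _ {A P} (P-pairing : IsConsecutivePairing A P) where

    pairing-next : ∀ d → P (next R d) ≡ A (proj₁ (next R d)) xor P d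
    pairing-next d = b2n-+⇒xor _ _ _
      (subst (λ d′ → b2n (P (next R d)) + b2n (P d′) ≡ b2n (A (proj₁ (next R d))))
             (prev-next d) (covers P-pairing (next R d)))

    y-edge-unpaired : ∀ d → A (proj₁ d) ≡ false → P d ≡ false
    y-edge-unpaired d y = b2n-+≡0 _ _ (trans (covers P-pairing d) (cong b2n y))

    leaf-edge-y : ∀ d → next R d ≡ d → A (proj₁ d) ≡ false
    leaf-edge-y d leaf with A (proj₁ d) in a
    ... | false = refl
    ... | true  = ⊥-elim (b2n-double≢1 (P d)
      (subst (λ d′ → b2n (P d) + b2n (P d′) ≡ 1)
             (trans (cong (prev R) (sym leaf)) (prev-next d))
             (trans (covers P-pairing d) (cong b2n a))))

  module _ {A P Q} (P-pairing : IsConsecutivePairing A P) (Q-pairing : IsConsecutivePairing A Q) where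

    difference-next : ∀ d → (P (next R d) xor Q (next R d)) ≡ (P d xor Q d)
    difference-next d rewrite pairing-next P-pairing d | pairing-next Q-pairing d =
      xor-cancelˡ (A (proj₁ (next R d))) (P d) (Q d)

    difference-iterate : ∀ k d → (P (iterate (next R) k d) xor Q (iterate (next R) k d)) ≡ (P d xor Q d)
    difference-iterate zero    d = refl
    difference-iterate (suc k) d = trans (difference-next _) (difference-iterate k d)

    difference-at-vertex : ∀ {d d′} → vert R d ≡ vert R d′ → (P d′ xor Q d′) ≡ (P d xor Q d)
    difference-at-vertex {d} {d′} same with σ-transitive d d′ same
    ... | k , reaches = subst (λ d″ → (P d″ xor Q d″) ≡ (P d xor Q d)) reaches (difference-iterate k d)

  specialAt : (Fin m → Bool) → Fin n → Dart m → Bool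
  specialAt A v d = not ⌊ vert R d FinP.≟ v ⌋ ∨ A (proj₁ d)

  Special : (Fin m → Bool) → Fin n → Set
  Special A v = ∀ d → vert R d ≡ v → A (proj₁ d) ≡ true

  isSpecial⁻ : ∀ {A v} → T (isSpecial R A v) → Special A v
  isSpecial⁻ {A} {v} t d at-v =
    to T-≡ (T-⌊⌋-⇒⁻ (vert R d FinP.≟ v) (allDart⁻ {specialAt A v} t d) at-v)

  isSpecial⁺ : ∀ {A v} → Special A v → T (isSpecial R A v)
  isSpecial⁺ {A} {v} s =
    allDart⁺ {specialAt A v} (λ d → T-⌊⌋-⇒⁺ (vert R d FinP.≟ v) (from T-≡ ∘ s d))

  flipAt : (Fin n → Bool) → (Dart m → Bool) → Dart m → Bool
  flipAt f P d = f (vert R d) xor P d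

  flip-pairing : ∀ {A P f} → IsConsecutivePairing A P → (∀ v → T (f v) → Special A v) →
                 IsConsecutivePairing A (flipAt f P)
  flip-pairing {f = f} p special .unpaired-at-leaf d leaf with f (vert R d) in fd
  ... | false = unpaired-at-leaf p d leaf
  ... | true  with () ← trans (sym (special (vert R d) (subst T (sym fd) tt) d refl)) (leaf-edge-y p d leaf)
  flip-pairing {P = P} {f} p special .covers d rewrite vert-prev d with f (vert R d) in fd
  ... | false = covers p d
  ... | true  = let n-edge = special (vert R d) (subst T (sym fd) tt) d refl in
    trans (b2n-+-not (P d) (P (prev R d)) (trans (covers p d) (cong b2n n-edge))) (cong b2n (sym n-edge))

  module _ (dartAt : Fin n → Dart m) (vert-dartAt : ∀ v → vert R (dartAt v) ≡ v)
           {A P₀} (P₀-pairing : IsConsecutivePairing A P₀) where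

    -- P differs from P₀ by a constant at each vertex; it is read off at the chosen dart.
    flipsOf : (Dart m → Bool) → Fin n → Bool
    flipsOf P v = P (dartAt v) xor P₀ (dartAt v)

    flipsOf-vert : ∀ {P} → IsConsecutivePairing A P → ∀ d → flipsOf P (vert R d) ≡ P d xor P₀ d
    flipsOf-vert p d = difference-at-vertex p P₀-pairing (sym (vert-dartAt (vert R d)))

    flipsOf-special : ∀ {P} → IsConsecutivePairing A P → ∀ v → T (flipsOf P v) → Special A v
    flipsOf-special {P} p v t d refl with A (proj₁ d) in y
    ... | true  = refl
    ... | false = ⊥-elim (subst T flips-nothing t)
      where
      flips-nothing : flipsOf P (vert R d) ≡ false
      flips-nothing = trans (flipsOf-vert p d)
                            (cong₂ _xor_ (y-edge-unpaired p d y) (y-edge-unpaired P₀-pairing d y))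

    pairings-of-Lucas : sumDartFun R (λ P → ι (isConsecutivePairing R A P)) ≡ 2 ^ Sp R A
    pairings-of-Lucas =
      trans (sumDartFun-correspondence n (isConsecutivePairing R A) (_⊆ᵇ isSpecial R A)
                                       (λ f → flipAt f P₀) flipsOf forth back)
            (sumFun-⊆ᵇ n (isSpecial R A))
      where
      forth : ∀ {P f} → T (isConsecutivePairing R A P) → f ≗ flipsOf P →
              T (f ⊆ᵇ isSpecial R A) × P ≗ flipAt f P₀
      forth {P} {f} t f≗flipsOf =
        allFin⁺ n (λ v → T-⇒⁺ (isSpecial⁺ ∘ flipsOf-special p v ∘ subst T (f≗flipsOf v))) ,
        λ d → sym (trans (cong (_xor P₀ d) (trans (f≗flipsOf (vert R d)) (flipsOf-vert p d)))
                         (xor-cancelʳ (P d) (P₀ d)))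
        where
        p : IsConsecutivePairing A P
        p = isConsecutivePairing⁻ t

      back : ∀ {P f} → T (f ⊆ᵇ isSpecial R A) → P ≗ flipAt f P₀ →
             T (isConsecutivePairing R A P) × f ≗ flipsOf P
      back {P} {f} f⊆special P≗flip =
        subst T (isConsecutivePairing-cong (λ _ → refl) (sym ∘ P≗flip))
                (isConsecutivePairing⁺ (flip-pairing P₀-pairing special)) ,
        λ v → sym (trans (cong (_xor P₀ (dartAt v)) (P≗flip (dartAt v)))
                         (trans (xor-cancelʳ _ _) (cong f (vert-dartAt v))))
        where
        special : ∀ v → T (f v) → Special A v
        special v fv = isSpecial⁻ (T-⇒⁻ (allFin⁻ n f⊆special v) fv)

  pairings : (Fin m → Bool) → ℕ
  pairings A = sumDartFun R (λ P → ι (isConsecutivePairing R A P))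

  pairings-cong : ∀ {A A′} → A ≗ A′ → pairings A ≡ pairings A′
  pairings-cong A≗A′ =
    sumDartFun-cong (λ P → cong ι (isConsecutivePairing-cong {P = P} A≗A′ (λ _ → refl)))

  pairings-count : (∀ v → ∃ λ d → vert R d ≡ v) →
                   ∀ A → pairings A ≡ (if isLucasColoring R A then 2 ^ Sp R A else 0)
  pairings-count has-dart A with isLucasColoring R A in lucas
  ... | false = sumDartFun-¬anyDartFun {isConsecutivePairing R A} _ (subst T lucas) (λ _ → ι-false)
  ... | true  =
    let (P₀ , t) = anyDartFun-∃ {isConsecutivePairing R A} (subst T (sym lucas) tt)
    in pairings-of-Lucas (proj₁ ∘ has-dart) (proj₂ ∘ has-dart) (isConsecutivePairing⁻ {A} {P₀} t)

  isPerfectMatching≡ : ∀ o P → isPerfectMatching R o P ≡ isConsecutivePairing R (not ∘ o) P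
  isPerfectMatching≡ o P =
    allDart-cong (λ d → cong ((not (fixed R d) ∨ not (P d)) ∧_)
                             (matched-once≡paired (o (proj₁ d)) (P d) (P (prev R d))))
    where
    matched-once≡paired : ∀ a x y →
                          ⌊ b2n a + b2n x + b2n y ℕ.≟ 1 ⌋ ≡ ⌊ b2n x + b2n y ℕ.≟ b2n (not a) ⌋
    matched-once≡paired false false false = refl
    matched-once≡paired false false true  = refl
    matched-once≡paired false true  false = refl
    matched-once≡paired false true  true  = refl
    matched-once≡paired true  false false = refl
    matched-once≡paired true  false true  = refl
    matched-once≡paired true  true  false = refl
    matched-once≡paired true  true  true  = refl

theorem5 : {n m : ℕ} (R : RotationSystem n m) → 2 ≤ n → Loopless R →
           Connected R → Planar R → numPerfectMatchings R ≡ lucasSum R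
theorem5 {m = m} R 2≤n _ connected _ = begin
    numPerfectMatchings R
  ≡⟨ sumFun-cong m (λ o → sumDartFun-cong R (λ P → cong ι (isPerfectMatching≡ R o P))) ⟩
    sumFun m (λ o → pairings R (not ∘ o))
  ≡⟨ sumFun-not m (pairings R) (pairings-cong R) ⟩
    sumFun m (pairings R)
  ≡⟨ sumFun-cong m (pairings-count R (every-vertex-has-dart R 2≤n connected)) ⟩
    lucasSum R
  ∎
  where open ≡-Reasoning
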